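{- For all formulas $\phi$ and $\psi$ and every variable $x$, the equations $\{x\mid\phi\vee\psi\}=\{x\mid\phi\}\,\&\,\{x\mid\psi\}$ and $\{x\mid\phi\,\&\,\psi\}=\{x\mid\phi\}\cap\{x\mid\psi\}$ are derivable.
   Context: Formal system. Objects are generated from the constant $\varnothing$ by: $(\alpha)^{\mathsf c}$, $(\alpha)^{\mathsf v}$ (variables are objects of this form), $(\alpha\,\&\,\beta)$ (federation/union/conjunction), $(\alpha\Rightarrow\beta)$ (containment/implication), $(\alpha\cap\beta)$ (intersection), and classes $\{x\mid\beta\}$ ($x$ a variable, which becomes a bound index). $\alpha[x:=\beta]$ replaces every free appearance of $x$ by $\beta$. A formula is an object of the form $\alpha\Rightarrow\beta$. Abbreviations: $\bot:=\varnothing^{\mathsf c}$; $\neg a:=(a\Rightarrow\bot)$; $\bar a:=(\varnothing\Rightarrow a)$; $a\vee b:=\overline{\bar a\cap\bar b}$; $a=b:=(a\Rightarrow b)\&(b\Rightarrow a)$; $a\neq b:=\neg(a=b)$; $\mathrm{Sing}(a):=(\bar a\neq a)\,\&\,((a\Rightarrow b)\Rightarrow(\bar b\vee a=b))$, with $b$ a variable; $a\in b:=\mathrm{Sing}(a)\&(b\Rightarrow a)$; $V:=\{x\mid\varnothing\}$. Rules: R1 from $\alpha$ and $\alpha\Rightarrow\beta$ infer $\beta$; R2 from $\alpha$ infer $\alpha[x:=\beta]$; R3 if $x$ does not appear in $\gamma$, from $\gamma\Rightarrow(\alpha\Rightarrow\beta)$ infer $\gamma\Rightarrow(\{x\mid\beta\}\Rightarrow\{x\mid\alpha\})$.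 Axioms ($a,b,c,d,x$ variables): A1 $((c\Rightarrow a)\&(c\Rightarrow(a\Rightarrow b)))\Rightarrow(c\Rightarrow b)$; A2 $((d\Rightarrow(a\Rightarrow b))\&(d\Rightarrow(b\Rightarrow c)))\Rightarrow(d\Rightarrow(a\Rightarrow c))$; A3 $((c\Rightarrow a)\&(c\Rightarrow b))\Rightarrow(c\Rightarrow(a\&b))$; A4 $(a\&b)\Rightarrow a$, $(a\&b)\Rightarrow b$; A5 $a\Rightarrow(a\cap b)$, $b\Rightarrow(a\cap b)$; A6 $((a\Rightarrow c)\&(b\Rightarrow c))\Rightarrow((a\cap b)\Rightarrow c)$; A7 $a\Rightarrow a$; A8 $a\Rightarrow\varnothing$; A9 $\bot\Rightarrow a$; A10 $(\varnothing\Rightarrow a)\Rightarrow((\varnothing\Rightarrow b)\Rightarrow(a\&b))$; A11 $(a\Rightarrow b)\Rightarrow(\varnothing\Rightarrow(a\Rightarrow b))$; A12 $(((a\Rightarrow b)\Rightarrow\bot)\Rightarrow\bot)\Rightarrow(a\Rightarrow b)$; A13 (schema) $a\in\{x\mid\alpha\}=(\mathrm{Sing}(a)\&\alpha[x:=a])$; A14a $a\Rightarrow\{x\mid x\in a\}$; A14b $(V\Rightarrow a)\Rightarrow(\{x\mid x\in a\}\Rightarrow a)$. -}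

module Defs where

open import Data.Nat using (ℕ; zero; suc)
import Data.Nat as ℕ
open import Data.Bool using (Bool; true; false)
open import Data.Product using (_×_; _,_)
open import Relation.Binary.PropositionalEquality using (_≡_; refl; cong; cong₂)
open import Relation.Nullary using (Dec; yes; no; ¬_)

infixr 5 _⇒_
infixr 6 _&_
infixr 6 _∩_

-- Objects, in locally nameless style: a class {x | β} is stored as
-- `cls body` where the variable x has been replaced by a bound index
-- (de Bruijn index, `bnd n`).  Variables are exactly the objects `α ᵛ`.
data Obj : Set where
  ∅    : Obj
  _ᶜ   : Obj → Obj
  _ᵛ   : Obj → Obj
  _&_  : Obj → Obj → Obj
  _⇒_  : Obj → Obj → Obj
  _∩_  : Obj → Obj → Obj
  bnd  : ℕ → Obj
  cls  : Obj → Obj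

private
  ᶜ-inj : ∀ {a b} → a ᶜ ≡ b ᶜ → a ≡ b
  ᶜ-inj refl = refl
  ᵛ-inj : ∀ {a b} → a ᵛ ≡ b ᵛ → a ≡ b
  ᵛ-inj refl = refl
  cls-inj : ∀ {a b} → cls a ≡ cls b → a ≡ b
  cls-inj refl = refl
  bnd-inj : ∀ {m n} → bnd m ≡ bnd n → m ≡ n
  bnd-inj refl = refl
  &-inj : ∀ {a b c d} → (a & b) ≡ (c & d) → (a ≡ c) × (b ≡ d)
  &-inj refl = refl , refl
  ⇒-inj : ∀ {a b c d} → (a ⇒ b) ≡ (c ⇒ d) → (a ≡ c) × (b ≡ d)
  ⇒-inj refl = refl , refl
  ∩-inj : ∀ {a b c d} → (a ∩ b) ≡ (c ∩ d) → (a ≡ c) × (b ≡ d)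
  ∩-inj refl = refl , refl

_≟_ : (a b : Obj) → Dec (a ≡ b)
∅ ≟ ∅ = yes refl
∅ ≟ (_ ᶜ) = no λ ()
∅ ≟ (_ ᵛ) = no λ ()
∅ ≟ (_ & _) = no λ ()
∅ ≟ (_ ⇒ _) = no λ ()
∅ ≟ (_ ∩ _) = no λ ()
∅ ≟ bnd _ = no λ ()
∅ ≟ cls _ = no λ ()
(a ᶜ) ≟ (b ᶜ) with a ≟ b
... | yes refl = yes refl
... | no ne = no λ e → ne (ᶜ-inj e)
(_ ᶜ) ≟ ∅ = no λ ()
(_ ᶜ) ≟ (_ ᵛ) = no λ ()
(_ ᶜ) ≟ (_ & _) = no λ ()
(_ ᶜ) ≟ (_ ⇒ _) = no λ ()
(_ ᶜ) ≟ (_ ∩ _) = no λ ()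
(_ ᶜ) ≟ bnd _ = no λ ()
(_ ᶜ) ≟ cls _ = no λ ()
(a ᵛ) ≟ (b ᵛ) with a ≟ b
... | yes refl = yes refl
... | no ne = no λ e → ne (ᵛ-inj e)
(_ ᵛ) ≟ ∅ = no λ ()
(_ ᵛ) ≟ (_ ᶜ) = no λ ()
(_ ᵛ) ≟ (_ & _) = no λ ()
(_ ᵛ) ≟ (_ ⇒ _) = no λ ()
(_ ᵛ) ≟ (_ ∩ _) = no λ ()
(_ ᵛ) ≟ bnd _ = no λ ()
(_ ᵛ) ≟ cls _ = no λ ()
(a & b) ≟ (c & d) with a ≟ c | b ≟ d
... | yes refl | yes refl = yes refl
... | no ne | _ = no λ e → ne (Data.Product.proj₁ (&-inj e))
  where import Data.Product
... | yes _ | no ne = no λ e → ne (Data.Product.proj₂ (&-inj e))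
  where import Data.Product
(_ & _) ≟ ∅ = no λ ()
(_ & _) ≟ (_ ᶜ) = no λ ()
(_ & _) ≟ (_ ᵛ) = no λ ()
(_ & _) ≟ (_ ⇒ _) = no λ ()
(_ & _) ≟ (_ ∩ _) = no λ ()
(_ & _) ≟ bnd _ = no λ ()
(_ & _) ≟ cls _ = no λ ()
(a ⇒ b) ≟ (c ⇒ d) with a ≟ c | b ≟ d
... | yes refl | yes refl = yes refl
... | no ne | _ = no λ e → ne (Data.Product.proj₁ (⇒-inj e))
  where import Data.Product
... | yes _ | no ne = no λ e → ne (Data.Product.proj₂ (⇒-inj e))
  where import Data.Product
(_ ⇒ _) ≟ ∅ = no λ ()
(_ ⇒ _) ≟ (_ ᶜ) = no λ ()
(_ ⇒ _) ≟ (_ ᵛ) = no λ ()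
(_ ⇒ _) ≟ (_ & _) = no λ ()
(_ ⇒ _) ≟ (_ ∩ _) = no λ ()
(_ ⇒ _) ≟ bnd _ = no λ ()
(_ ⇒ _) ≟ cls _ = no λ ()
(a ∩ b) ≟ (c ∩ d) with a ≟ c | b ≟ d
... | yes refl | yes refl = yes refl
... | no ne | _ = no λ e → ne (Data.Product.proj₁ (∩-inj e))
  where import Data.Product
... | yes _ | no ne = no λ e → ne (Data.Product.proj₂ (∩-inj e))
  where import Data.Product
(_ ∩ _) ≟ ∅ = no λ ()
(_ ∩ _) ≟ (_ ᶜ) = no λ ()
(_ ∩ _) ≟ (_ ᵛ) = no λ ()
(_ ∩ _) ≟ (_ & _) = no λ ()
(_ ∩ _) ≟ (_ ⇒ _) = no λ ()
(_ ∩ _) ≟ bnd _ = no λ ()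
(_ ∩ _) ≟ cls _ = no λ ()
bnd m ≟ bnd n with m ℕ.≟ n
... | yes refl = yes refl
... | no ne = no λ e → ne (bnd-inj e)
bnd _ ≟ ∅ = no λ ()
bnd _ ≟ (_ ᶜ) = no λ ()
bnd _ ≟ (_ ᵛ) = no λ ()
bnd _ ≟ (_ & _) = no λ ()
bnd _ ≟ (_ ⇒ _) = no λ ()
bnd _ ≟ (_ ∩ _) = no λ ()
bnd _ ≟ cls _ = no λ ()
cls a ≟ cls b with a ≟ b
... | yes refl = yes refl
... | no ne = no λ e → ne (cls-inj e)
cls _ ≟ ∅ = no λ ()
cls _ ≟ (_ ᶜ) = no λ ()
cls _ ≟ (_ ᵛ) = no λ ()
cls _ ≟ (_ & _) = no λ ()
cls _ ≟ (_ ⇒ _) = no λ ()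
cls _ ≟ (_ ∩ _) = no λ ()
cls _ ≟ bnd _ = no λ ()

_[_≔_] : Obj → Obj → Obj → Obj
∅ [ x ≔ β ] = ∅
(α ᶜ) [ x ≔ β ] = (α [ x ≔ β ]) ᶜ
(α ᵛ) [ x ≔ β ] with (α ᵛ) ≟ x
... | yes _ = β
... | no _ = α ᵛ
(α & γ) [ x ≔ β ] = (α [ x ≔ β ]) & (γ [ x ≔ β ])
(α ⇒ γ) [ x ≔ β ] = (α [ x ≔ β ]) ⇒ (γ [ x ≔ β ])
(α ∩ γ) [ x ≔ β ] = (α [ x ≔ β ]) ∩ (γ [ x ≔ β ])
bnd n [ x ≔ β ] = bnd n
cls α [ x ≔ β ] = cls (α [ x ≔ β ])

close : ℕ → Obj → Obj → Obj
close k x ∅ = ∅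
close k x (α ᶜ) = close k x α ᶜ
close k x (α ᵛ) with (α ᵛ) ≟ x
... | yes _ = bnd k
... | no _ = α ᵛ
close k x (α & γ) = close k x α & close k x γ
close k x (α ⇒ γ) = close k x α ⇒ close k x γ
close k x (α ∩ γ) = close k x α ∩ close k x γ
close k x (bnd n) = bnd n
close k x (cls α) = cls (close (suc k) x α)

⟦_∣_⟧ : Obj → Obj → Obj
⟦ x ∣ β ⟧ = cls (close 0 x β)

Appears : Obj → Obj → Bool
Appears x ∅ = false
Appears x (α ᶜ) = Appears x α
Appears x (α ᵛ) with (α ᵛ) ≟ x
... | yes _ = true
... | no _ = false
Appears x (α & γ) = Data.Bool._∨_ (Appears x α) (Appears x γ)
Appears x (α ⇒ γ) = Data.Bool._∨_ (Appears x α) (Appears x γ)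
Appears x (α ∩ γ) = Data.Bool._∨_ (Appears x α) (Appears x γ)
Appears x (bnd n) = false
Appears x (cls α) = Appears x α

⊥ₒ : Obj
⊥ₒ = ∅ ᶜ

¬ₒ_ : Obj → Obj
¬ₒ a = a ⇒ ⊥ₒ

‾_ : Obj → Obj
‾ a = ∅ ⇒ a

_∨ₒ_ : Obj → Obj → Obj
a ∨ₒ b = ‾ ((‾ a) ∩ (‾ b))

_≐_ : Obj → Obj → Obj
a ≐ b = (a ⇒ b) & (b ⇒ a)

_≠ₒ_ : Obj → Obj → Obj
a ≠ₒ b = ¬ₒ (a ≐ b)

vx va vb vc vd : Obj
vx = ∅ ᵛ
va = (∅ ᶜ) ᵛ
vb = ((∅ ᶜ) ᶜ) ᵛ
vc = (((∅ ᶜ) ᶜ) ᶜ) ᵛ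
vd = ((((∅ ᶜ) ᶜ) ᶜ) ᶜ) ᵛ

Sing : Obj → Obj
Sing a = ((‾ a) ≠ₒ a) & ((a ⇒ vb) ⇒ ((‾ vb) ∨ₒ (a ≐ vb)))

_∈ₒ_ : Obj → Obj → Obj
a ∈ₒ b = Sing a & (b ⇒ a)

Vₒ : Obj
Vₒ = ⟦ vx ∣ ∅ ⟧

data ⊢_ : Obj → Set where
  R1 : ∀ {α β} → ⊢ α → ⊢ (α ⇒ β) → ⊢ β
  R2 : ∀ {α} (x β : Obj) → ⊢ α → ⊢ (α [ x ᵛ ≔ β ])
  R3 : ∀ {γ α β} (x : Obj) → Appears (x ᵛ) γ ≡ false →
       ⊢ (γ ⇒ (α ⇒ β)) → ⊢ (γ ⇒ (⟦ x ᵛ ∣ β ⟧ ⇒ ⟦ x ᵛ ∣ α ⟧))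
  A1  : ⊢ (((vc ⇒ va) & (vc ⇒ (va ⇒ vb))) ⇒ (vc ⇒ vb))
  A2  : ⊢ (((vd ⇒ (va ⇒ vb)) & (vd ⇒ (vb ⇒ vc))) ⇒ (vd ⇒ (va ⇒ vc)))
  A3  : ⊢ (((vc ⇒ va) & (vc ⇒ vb)) ⇒ (vc ⇒ (va & vb)))
  A4l : ⊢ ((va & vb) ⇒ va)
  A4r : ⊢ ((va & vb) ⇒ vb)
  A5l : ⊢ (va ⇒ (va ∩ vb))
  A5r : ⊢ (vb ⇒ (va ∩ vb))
  A6  : ⊢ (((va ⇒ vc) & (vb ⇒ vc)) ⇒ ((va ∩ vb) ⇒ vc))
  A7  : ⊢ (va ⇒ va)
  A8  : ⊢ (va ⇒ ∅)
  A9  : ⊢ (⊥ₒ ⇒ va)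
  A10 : ⊢ ((∅ ⇒ va) ⇒ ((∅ ⇒ vb) ⇒ (va & vb)))
  A11 : ⊢ ((va ⇒ vb) ⇒ (∅ ⇒ (va ⇒ vb)))
  A12 : ⊢ ((((va ⇒ vb) ⇒ ⊥ₒ) ⇒ ⊥ₒ) ⇒ (va ⇒ vb))
  A13 : (α : Obj) → ⊢ ((va ∈ₒ ⟦ vx ∣ α ⟧) ≐ (Sing va & (α [ vx ≔ va ])))
  A14a : ⊢ (va ⇒ ⟦ vx ∣ vx ∈ₒ va ⟧)
  A14b : ⊢ ((Vₒ ⇒ va) ⇒ (⟦ vx ∣ vx ∈ₒ va ⟧ ⇒ va))

module Submission where

-- Both equations are derived for generic formulas
-- P ⇒ Q and R ⇒ S (P, Q, R, S standard variables); every instance then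
-- follows from a substitution theorem: derivability is preserved when
-- finitely many standard variables are replaced simultaneously by arbitrary
-- objects (R2 done twice over: rename to fresh variables, then substitute).
-- The same theorem gives the axioms A1-A11 at arbitrary objects, hence a
-- small Hilbert calculus (reasoning under hypotheses, ∨-introduction and
-- ∨-elimination).  With A13/A14 we get membership reasoning: x ∈ {x | α}
-- is Sing(x) & α, and a containment c ⇒ d follows from x ∈ d ⇒ x ∈ c.
-- Each equation is one inclusion by R3 and one by membership.  The theorem
-- substitutes P, Q, R, S by φ₁, φ₂, ψ₁, ψ₂ with x closed to the bound index
-- of the surrounding class, which turns {x | P ⇒ Q} into {x | φ₁ ⇒ φ₂}.

open import Defs
open import Data.Bool using (true; false; if_then_else_; T; _∨_)
open import Data.List using (List; []; _∷_; length)
open import Data.Nat using (ℕ; zero; suc; _+_; _≤_; _<_; _<ᵇ_)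
open import Data.Nat.Properties
  using (≤-refl; ≤-trans; <⇒≤; <-trans; <-irrefl; <-cmp; ≤⇒≯; <⇒<ᵇ; <ᵇ⇒<;
         m≤m+n; m≤n+m; n≤1+n; m<1+n⇒m<n∨m≡n)
open import Data.Product using (_×_; _,_; proj₁; proj₂)
open import Data.Sum using (inj₁; inj₂)
open import Relation.Binary.Definitions using (tri<; tri≈; tri>)
open import Relation.Binary.PropositionalEquality
  using (_≡_; _≢_; refl; sym; trans; cong; cong₂; subst)
open import Relation.Nullary using (yes; no; contradiction)

-- Schemas: objects with metavariables # i, standing for the i-th entry of
-- an environment ρ : ℕ → Obj.
infixr 5 _⇒ˢ_
infixr 6 _&ˢ_ _∩ˢ_

data Schema : Set where
  #_   : ℕ → Schema
  ∅ˢ   : Schema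
  _ᶜˢ  : Schema → Schema
  _&ˢ_ _⇒ˢ_ _∩ˢ_ : Schema → Schema → Schema
  bndˢ : ℕ → Schema
  clsˢ : Schema → Schema

⟪_⟫ : Schema → (ℕ → Obj) → Obj
⟪ # i ⟫ ρ = ρ i
⟪ ∅ˢ ⟫ ρ = ∅
⟪ t ᶜˢ ⟫ ρ = ⟪ t ⟫ ρ ᶜ
⟪ s &ˢ t ⟫ ρ = ⟪ s ⟫ ρ & ⟪ t ⟫ ρ
⟪ s ⇒ˢ t ⟫ ρ = ⟪ s ⟫ ρ ⇒ ⟪ t ⟫ ρ
⟪ s ∩ˢ t ⟫ ρ = ⟪ s ⟫ ρ ∩ ⟪ t ⟫ ρ
⟪ bndˢ n ⟫ ρ = bnd n
⟪ clsˢ t ⟫ ρ = cls (⟪ t ⟫ ρ)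

⟪⟫-subst : ∀ t ρ v β → (⟪ t ⟫ ρ) [ v ≔ β ] ≡ ⟪ t ⟫ (λ i → ρ i [ v ≔ β ])
⟪⟫-subst (# i) ρ v β = refl
⟪⟫-subst ∅ˢ ρ v β = refl
⟪⟫-subst (t ᶜˢ) ρ v β = cong _ᶜ (⟪⟫-subst t ρ v β)
⟪⟫-subst (s &ˢ t) ρ v β = cong₂ _&_ (⟪⟫-subst s ρ v β) (⟪⟫-subst t ρ v β)
⟪⟫-subst (s ⇒ˢ t) ρ v β = cong₂ _⇒_ (⟪⟫-subst s ρ v β) (⟪⟫-subst t ρ v β)
⟪⟫-subst (s ∩ˢ t) ρ v β = cong₂ _∩_ (⟪⟫-subst s ρ v β) (⟪⟫-subst t ρ v β)
⟪⟫-subst (bndˢ n) ρ v β = refl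
⟪⟫-subst (clsˢ t) ρ v β = cong cls (⟪⟫-subst t ρ v β)

⟪⟫-cong : ∀ t {ρ σ} → (∀ i → ρ i ≡ σ i) → ⟪ t ⟫ ρ ≡ ⟪ t ⟫ σ
⟪⟫-cong (# i) e = e i
⟪⟫-cong ∅ˢ e = refl
⟪⟫-cong (t ᶜˢ) e = cong _ᶜ (⟪⟫-cong t e)
⟪⟫-cong (s &ˢ t) e = cong₂ _&_ (⟪⟫-cong s e) (⟪⟫-cong t e)
⟪⟫-cong (s ⇒ˢ t) e = cong₂ _⇒_ (⟪⟫-cong s e) (⟪⟫-cong t e)
⟪⟫-cong (s ∩ˢ t) e = cong₂ _∩_ (⟪⟫-cong s e) (⟪⟫-cong t e)
⟪⟫-cong (bndˢ n) e = refl
⟪⟫-cong (clsˢ t) e = cong cls (⟪⟫-cong t e)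

R2-instance : ∀ t {σ σ′} (x β : Obj) → (∀ i → σ i [ x ᵛ ≔ β ] ≡ σ′ i) →
              ⊢ ⟪ t ⟫ σ → ⊢ ⟪ t ⟫ σ′
R2-instance t {σ} x β e d = subst ⊢_ (trans (⟪⟫-subst t σ (x ᵛ) β) (⟪⟫-cong t e)) (R2 x β d)

-- The standard variables (∅ᶜ…ᶜ)ᵛ; x, a, b, c, d of the axioms are std 0 … std 4.
-- Distinct numerals name distinct variables.
numeral : ℕ → Obj
numeral zero = ∅
numeral (suc n) = numeral n ᶜ

std : ℕ → Obj
std i = numeral i ᵛ

unᶜ : Obj → Obj
unᶜ (a ᶜ) = a
unᶜ a = a

numeral-injective : ∀ i j → numeral i ≡ numeral j → i ≡ j
numeral-injective zero zero e = refl
numeral-injective zero (suc j) ()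
numeral-injective (suc i) zero ()
numeral-injective (suc i) (suc j) e = cong suc (numeral-injective i j (cong unᶜ e))

subst-self : ∀ v β → (v ᵛ) [ v ᵛ ≔ β ] ≡ β
subst-self v β with (v ᵛ) ≟ (v ᵛ)
... | yes _ = refl
... | no v≢v = contradiction refl v≢v

subst-other : ∀ w v β → w ≢ v → (w ᵛ) [ v ᵛ ≔ β ] ≡ w ᵛ
subst-other w v β w≢v with (w ᵛ) ≟ (v ᵛ)
... | yes refl = contradiction refl w≢v
... | no _ = refl

∨-false : ∀ a b → a ∨ b ≡ false → (a ≡ false) × (b ≡ false)
∨-false false false refl = refl , refl

subst-fresh : ∀ v α β → Appears v α ≡ false → α [ v ≔ β ] ≡ α
subst-fresh v ∅ β h = refl
subst-fresh v (α ᶜ) β h = cong _ᶜ (subst-fresh v α β h)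
subst-fresh v (α ᵛ) β h with (α ᵛ) ≟ v
subst-fresh v (α ᵛ) β () | yes _
... | no _ = refl
subst-fresh v (α & γ) β h =
  cong₂ _&_ (subst-fresh v α β (proj₁ (∨-false _ _ h))) (subst-fresh v γ β (proj₂ (∨-false _ _ h)))
subst-fresh v (α ⇒ γ) β h =
  cong₂ _⇒_ (subst-fresh v α β (proj₁ (∨-false _ _ h))) (subst-fresh v γ β (proj₂ (∨-false _ _ h)))
subst-fresh v (α ∩ γ) β h =
  cong₂ _∩_ (subst-fresh v α β (proj₁ (∨-false _ _ h))) (subst-fresh v γ β (proj₂ (∨-false _ _ h)))
subst-fresh v (bnd n) β h = refl
subst-fresh v (cls α) β h = cong cls (subst-fresh v α β h)

close-fresh : ∀ k v α → Appears v α ≡ false → close k v α ≡ α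
close-fresh k v ∅ h = refl
close-fresh k v (α ᶜ) h = cong _ᶜ (close-fresh k v α h)
close-fresh k v (α ᵛ) h with (α ᵛ) ≟ v
close-fresh k v (α ᵛ) () | yes _
... | no _ = refl
close-fresh k v (α & γ) h =
  cong₂ _&_ (close-fresh k v α (proj₁ (∨-false _ _ h))) (close-fresh k v γ (proj₂ (∨-false _ _ h)))
close-fresh k v (α ⇒ γ) h =
  cong₂ _⇒_ (close-fresh k v α (proj₁ (∨-false _ _ h))) (close-fresh k v γ (proj₂ (∨-false _ _ h)))
close-fresh k v (α ∩ γ) h =
  cong₂ _∩_ (close-fresh k v α (proj₁ (∨-false _ _ h))) (close-fresh k v γ (proj₂ (∨-false _ _ h)))
close-fresh k v (bnd n) h = refl
close-fresh k v (cls α) h = cong cls (close-fresh (suc k) v α h)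

size : Obj → ℕ
size ∅ = 1
size (a ᶜ) = suc (size a)
size (a ᵛ) = suc (size a)
size (a & b) = suc (size a + size b)
size (a ⇒ b) = suc (size a + size b)
size (a ∩ b) = suc (size a + size b)
size (bnd n) = 1
size (cls a) = suc (size a)

summand-left : ∀ a b {s} → suc (a + b) ≤ s → a ≤ s
summand-left a b = ≤-trans (≤-trans (m≤m+n a b) (n≤1+n _))

summand-right : ∀ a b {s} → suc (a + b) ≤ s → b ≤ s
summand-right a b = ≤-trans (≤-trans (m≤n+m b a) (n≤1+n _))

-- A variable t ᵛ is strictly bigger than t, so it cannot appear in any
-- object that is not bigger than t: the source of fresh variables.
fresh-by-size : ∀ t α → size α ≤ size t → Appears (t ᵛ) α ≡ false
fresh-by-size t ∅ s = refl
fresh-by-size t (α ᶜ) s = fresh-by-size t α (≤-trans (n≤1+n _) s)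
fresh-by-size t (α ᵛ) s with (α ᵛ) ≟ (t ᵛ)
... | yes refl = contradiction s (<-irrefl refl)
... | no _ = refl
fresh-by-size t (α & γ) s
  rewrite fresh-by-size t α (summand-left _ _ s) | fresh-by-size t γ (summand-right _ _ s) = refl
fresh-by-size t (α ⇒ γ) s
  rewrite fresh-by-size t α (summand-left _ _ s) | fresh-by-size t γ (summand-right _ _ s) = refl
fresh-by-size t (α ∩ γ) s
  rewrite fresh-by-size t α (summand-left _ _ s) | fresh-by-size t γ (summand-right _ _ s) = refl
fresh-by-size t (bnd n) s = refl
fresh-by-size t (cls α) s = fresh-by-size t α (≤-trans (n≤1+n _) s)

override : ℕ → (ℕ → Obj) → (ℕ → Obj) → ℕ → Obj
override k f g i = if i <ᵇ k then f i else g i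

override-< : ∀ {k} f g {i} → i < k → override k f g i ≡ f i
override-< {k} f g {i} i<k with i <ᵇ k | <⇒<ᵇ i<k
... | true | _ = refl

override-≥ : ∀ {k} f g {i} → k ≤ i → override k f g i ≡ g i
override-≥ {k} f g {i} k≤i with i <ᵇ k in eq
... | true = contradiction (<ᵇ⇒< i k (subst T (sym eq) _)) (≤⇒≯ k≤i)
... | false = refl

override-absorb : ∀ k f g h i → override k f (override k g h) i ≡ override k f h i
override-absorb k f g h i with i <ᵇ k
... | true = refl
... | false = refl

-- Its fresh
-- variables are fresh k = (hull & std k)ᵛ, where hull collects ρ 0 … ρ (n-1):
-- they avoid every ρ i, differ from every standard variable and from
-- each other.
module Instantiation (n : ℕ) (ρ : ℕ → Obj) (t : Schema) (base : ⊢ ⟪ t ⟫ std) where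

  hull : ℕ → Obj
  hull zero = ∅
  hull (suc k) = ρ k & hull k

  hull-bounds : ∀ i k → i < k → size (ρ i) ≤ size (hull k)
  hull-bounds i (suc k) i<1+k with m<1+n⇒m<n∨m≡n i<1+k
  ... | inj₁ i<k = ≤-trans (hull-bounds i k i<k) (summand-right (size (ρ k)) _ ≤-refl)
  ... | inj₂ refl = summand-left _ (size (hull k)) ≤-refl

  freshName : ℕ → Obj
  freshName k = hull n & std k

  fresh : ℕ → Obj
  fresh k = freshName k ᵛ

  fresh-avoids : ∀ k i → i < n → Appears (fresh k) (ρ i) ≡ false
  fresh-avoids k i i<n =
    fresh-by-size (freshName k) (ρ i) (≤-trans (hull-bounds i n i<n) (summand-left _ (size (std k)) ≤-refl))

  freshName≢numeral : ∀ k j → freshName k ≢ numeral j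
  freshName≢numeral k zero ()
  freshName≢numeral k (suc j) ()

  freshName-injective : ∀ k j → freshName k ≡ freshName j → k ≡ j
  freshName-injective k j e = numeral-injective k j (cong (λ { (_ & (m ᵛ)) → m ; m → m }) e)

  -- Phase 1: rename std 0 … std (k-1) to their fresh variables.
  renamed : ℕ → ℕ → Obj
  renamed k = override k fresh std

  rename-step : ∀ k i → renamed k i [ std k ≔ fresh k ] ≡ renamed (suc k) i
  rename-step k i with <-cmp i k
  ... | tri< i<k _ _
    rewrite override-< fresh std i<k | override-< fresh std (<-trans i<k (≤-refl {suc k})) =
      subst-other (freshName i) (numeral k) (fresh k) (freshName≢numeral i k)
  ... | tri≈ _ refl _
    rewrite override-≥ fresh std (≤-refl {i}) | override-< fresh std (≤-refl {suc i}) =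
      subst-self (numeral i) (fresh i)
  ... | tri> _ i≢k k<i
    rewrite override-≥ fresh std (<⇒≤ k<i) | override-≥ fresh std k<i =
      subst-other (numeral i) (numeral k) (fresh k) (λ e → i≢k (numeral-injective i k e))

  rename-all : ∀ k → ⊢ ⟪ t ⟫ (renamed k)
  rename-all zero = base
  rename-all (suc k) = R2-instance t (numeral k) (fresh k) (rename-step k) (rename-all k)

  -- Phase 2: replace fresh 0 … fresh (k-1) by ρ 0 … ρ (k-1).
  instantiated : ℕ → ℕ → Obj
  instantiated k = override k ρ (renamed n)

  renamed-unmoved : ∀ k i → k < i → renamed n i [ fresh k ≔ ρ k ] ≡ renamed n i
  renamed-unmoved k i k<i with <-cmp i n
  ... | tri< i<n _ _ rewrite override-< fresh std i<n =
    subst-other (freshName i) (freshName k) (ρ k) (λ e → <-irrefl (freshName-injective k i (sym e)) k<i)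
  ... | tri≈ _ refl _ rewrite override-≥ fresh std (≤-refl {i}) =
    subst-other (numeral i) (freshName k) (ρ k) (λ e → freshName≢numeral k i (sym e))
  ... | tri> _ _ n<i rewrite override-≥ fresh std (<⇒≤ n<i) =
    subst-other (numeral i) (freshName k) (ρ k) (λ e → freshName≢numeral k i (sym e))

  instantiate-step : ∀ k → k < n → ∀ i → instantiated k i [ fresh k ≔ ρ k ] ≡ instantiated (suc k) i
  instantiate-step k k<n i with <-cmp i k
  ... | tri< i<k _ _
    rewrite override-< ρ (renamed n) i<k | override-< ρ (renamed n) (<-trans i<k (≤-refl {suc k})) =
      subst-fresh (fresh k) (ρ i) (ρ k) (fresh-avoids k i (<-trans i<k k<n))
  ... | tri≈ _ refl _
    rewrite override-≥ ρ (renamed n) (≤-refl {i}) | override-< ρ (renamed n) (≤-refl {suc i})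
          | override-< fresh std k<n =
      subst-self (freshName i) (ρ i)
  ... | tri> _ _ k<i
    rewrite override-≥ ρ (renamed n) (<⇒≤ k<i) | override-≥ ρ (renamed n) k<i =
      renamed-unmoved k i k<i

  instantiation : ∀ k → k ≤ n → ⊢ ⟪ t ⟫ (instantiated k)
  instantiation zero _ = rename-all n
  instantiation (suc k) k<n =
    R2-instance t (freshName k) (ρ k) (instantiate-step k k<n) (instantiation k (<⇒≤ k<n))

  result : ⊢ ⟪ t ⟫ (override n ρ std)
  result = subst ⊢_ (⟪⟫-cong t (override-absorb n ρ fresh std)) (instantiation n ≤-refl)

-- The i-th entry of a list (∅ past its end).
_!_ : List Obj → ℕ → Obj
[] ! i = ∅
(a ∷ as) ! zero = a
(a ∷ as) ! suc i = as ! i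

instantiate : ∀ t (as : List Obj) → ⊢ ⟪ t ⟫ std → ⊢ ⟪ t ⟫ (override (length as) (as !_) std)
instantiate t as = Instantiation.result (length as) (as !_) t

aˢ bˢ cˢ dˢ : Schema
aˢ = # 1
bˢ = # 2
cˢ = # 3
dˢ = # 4

A1′ : ∀ c a b → ⊢ (((c ⇒ a) & (c ⇒ (a ⇒ b))) ⇒ (c ⇒ b))
A1′ c a b = instantiate (((cˢ ⇒ˢ aˢ) &ˢ (cˢ ⇒ˢ (aˢ ⇒ˢ bˢ))) ⇒ˢ (cˢ ⇒ˢ bˢ)) (vx ∷ a ∷ b ∷ c ∷ []) A1

A2′ : ∀ d a b c → ⊢ (((d ⇒ (a ⇒ b)) & (d ⇒ (b ⇒ c))) ⇒ (d ⇒ (a ⇒ c)))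
A2′ d a b c =
  instantiate (((dˢ ⇒ˢ (aˢ ⇒ˢ bˢ)) &ˢ (dˢ ⇒ˢ (bˢ ⇒ˢ cˢ))) ⇒ˢ (dˢ ⇒ˢ (aˢ ⇒ˢ cˢ))) (vx ∷ a ∷ b ∷ c ∷ d ∷ []) A2

A3′ : ∀ c a b → ⊢ (((c ⇒ a) & (c ⇒ b)) ⇒ (c ⇒ (a & b)))
A3′ c a b = instantiate (((cˢ ⇒ˢ aˢ) &ˢ (cˢ ⇒ˢ bˢ)) ⇒ˢ (cˢ ⇒ˢ (aˢ &ˢ bˢ))) (vx ∷ a ∷ b ∷ c ∷ []) A3

A4l′ : ∀ a b → ⊢ ((a & b) ⇒ a)
A4l′ a b = instantiate ((aˢ &ˢ bˢ) ⇒ˢ aˢ) (vx ∷ a ∷ b ∷ []) A4l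

A4r′ : ∀ a b → ⊢ ((a & b) ⇒ b)
A4r′ a b = instantiate ((aˢ &ˢ bˢ) ⇒ˢ bˢ) (vx ∷ a ∷ b ∷ []) A4r

A5l′ : ∀ a b → ⊢ (a ⇒ (a ∩ b))
A5l′ a b = instantiate (aˢ ⇒ˢ (aˢ ∩ˢ bˢ)) (vx ∷ a ∷ b ∷ []) A5l

A5r′ : ∀ a b → ⊢ (b ⇒ (a ∩ b))
A5r′ a b = instantiate (bˢ ⇒ˢ (aˢ ∩ˢ bˢ)) (vx ∷ a ∷ b ∷ []) A5r

A6′ : ∀ a b c → ⊢ (((a ⇒ c) & (b ⇒ c)) ⇒ ((a ∩ b) ⇒ c))
A6′ a b c = instantiate (((aˢ ⇒ˢ cˢ) &ˢ (bˢ ⇒ˢ cˢ)) ⇒ˢ ((aˢ ∩ˢ bˢ) ⇒ˢ cˢ)) (vx ∷ a ∷ b ∷ c ∷ []) A6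

A7′ : ∀ a → ⊢ (a ⇒ a)
A7′ a = instantiate (aˢ ⇒ˢ aˢ) (vx ∷ a ∷ []) A7

A8′ : ∀ a → ⊢ (a ⇒ ∅)
A8′ a = instantiate (aˢ ⇒ˢ ∅ˢ) (vx ∷ a ∷ []) A8

A10′ : ∀ a b → ⊢ ((∅ ⇒ a) ⇒ ((∅ ⇒ b) ⇒ (a & b)))
A10′ a b = instantiate ((∅ˢ ⇒ˢ aˢ) ⇒ˢ ((∅ˢ ⇒ˢ bˢ) ⇒ˢ (aˢ &ˢ bˢ))) (vx ∷ a ∷ b ∷ []) A10

A11′ : ∀ a b → ⊢ ((a ⇒ b) ⇒ (∅ ⇒ (a ⇒ b)))
A11′ a b = instantiate ((aˢ ⇒ˢ bˢ) ⇒ˢ (∅ˢ ⇒ˢ (aˢ ⇒ˢ bˢ))) (vx ∷ a ∷ b ∷ []) A11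

-- A Hilbert calculus.  ‾ a = ∅ ⇒ a behaves like "a holds outright"; the
-- basic rules R1 + A1-A3 act on implications under a hypothesis h.
⊢∅ : ⊢ ∅
⊢∅ = R1 (A7′ ∅) (A8′ (∅ ⇒ ∅))

‾-intro : ∀ {a b} → ⊢ (a ⇒ b) → ⊢ (‾ (a ⇒ b))
‾-intro {a} {b} d = R1 d (A11′ a b)

&-intro : ∀ {a b} → ⊢ (‾ a) → ⊢ (‾ b) → ⊢ (a & b)
&-intro {a} {b} da db = R1 db (R1 da (A10′ a b))

&-intro⇒ : ∀ {a b c d} → ⊢ (a ⇒ b) → ⊢ (c ⇒ d) → ⊢ ((a ⇒ b) & (c ⇒ d))
&-intro⇒ d₁ d₂ = &-intro (‾-intro d₁) (‾-intro d₂)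

mp-under : ∀ {h a b} → ⊢ (h ⇒ a) → ⊢ (h ⇒ (a ⇒ b)) → ⊢ (h ⇒ b)
mp-under {h} {a} {b} d₁ d₂ = R1 (&-intro⇒ d₁ d₂) (A1′ h a b)

&-under : ∀ {h a b} → ⊢ (h ⇒ a) → ⊢ (h ⇒ b) → ⊢ (h ⇒ (a & b))
&-under {h} {a} {b} d₁ d₂ = R1 (&-intro⇒ d₁ d₂) (A3′ h a b)

trans-under : ∀ {h a b c} → ⊢ (h ⇒ (a ⇒ b)) → ⊢ (h ⇒ (b ⇒ c)) → ⊢ (h ⇒ (a ⇒ c))
trans-under {h} {a} {b} {c} d₁ d₂ = R1 (&-intro⇒ d₁ d₂) (A2′ h a b c)

⇒-trans : ∀ {a b c} → ⊢ (a ⇒ b) → ⊢ (b ⇒ c) → ⊢ (a ⇒ c)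
⇒-trans d₁ d₂ = R1 ⊢∅ (trans-under (‾-intro d₁) (‾-intro d₂))

‾-elim : ∀ a → ⊢ (‾ a ⇒ a)
‾-elim a = mp-under (A8′ (‾ a)) (A7′ (‾ a))

-- h is stable when it implies ‾ h; implications are stable by A11, and so
-- are conjunctions of stable objects.  Stable hypotheses can be weakened.
Stable : Obj → Set
Stable h = ⊢ (h ⇒ ‾ h)

⇒-stable : ∀ a b → Stable (a ⇒ b)
⇒-stable = A11′

&-stable : ∀ {a b} → Stable a → Stable b → Stable (a & b)
&-stable {a} {b} sa sb = ⇒-trans (&-under (⇒-trans (A4l′ a b) sa) (⇒-trans (A4r′ a b) sb)) (A3′ ∅ a b)

weaken : ∀ {h p} → Stable h → ⊢ (‾ p) → ⊢ (h ⇒ p)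
weaken {h} {p} sh dp = ⇒-trans sh (⇒-trans (R1 dp (A10′ p h)) (A4l′ p h))

weaken⇒ : ∀ {h a b} → Stable h → ⊢ (a ⇒ b) → ⊢ (h ⇒ (a ⇒ b))
weaken⇒ sh d = weaken sh (‾-intro d)

‾-mono : ∀ {a b} → ⊢ (a ⇒ b) → ⊢ (‾ a ⇒ ‾ b)
‾-mono {a} d = trans-under (A7′ (‾ a)) (weaken⇒ (⇒-stable ∅ a) d)

⇒-antitone : ∀ {a b} c → ⊢ (a ⇒ b) → ⊢ ((b ⇒ c) ⇒ (a ⇒ c))
⇒-antitone {b = b} c d = trans-under (weaken⇒ (⇒-stable b c) d) (A7′ (b ⇒ c))

∩-elim-under : ∀ {h a b c} → Stable h → ⊢ (h ⇒ (a ⇒ c)) → ⊢ (h ⇒ (b ⇒ c)) → ⊢ (h ⇒ ((a ∩ b) ⇒ c))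
∩-elim-under {h} {a} {b} {c} sh d₁ d₂ = mp-under (&-under d₁ d₂) (weaken⇒ sh (A6′ a b c))

curry-under : ∀ {s f c} → Stable s → Stable f → ⊢ ((s & f) ⇒ c) → ⊢ (s ⇒ (f ⇒ c))
curry-under {s} {f} ss sf d = trans-under pair (weaken⇒ ss d)
  where
    pair : ⊢ (s ⇒ (f ⇒ (s & f)))
    pair = trans-under (weaken⇒ ss sf) (⇒-trans ss (A10′ s f))

∨-intro-l : ∀ {f} g → Stable f → ⊢ (f ⇒ (f ∨ₒ g))
∨-intro-l {f} g sf = ⇒-trans sf (⇒-trans (⇒-stable ∅ f) (‾-mono (A5l′ (‾ f) (‾ g))))

∨-intro-r : ∀ f {g} → Stable g → ⊢ (g ⇒ (f ∨ₒ g))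
∨-intro-r f {g} sg = ⇒-trans sg (⇒-trans (⇒-stable ∅ g) (‾-mono (A5r′ (‾ f) (‾ g))))

∨-elim : ∀ {s f g c} → Stable s → Stable f → Stable g →
         ⊢ ((s & f) ⇒ c) → ⊢ ((s & g) ⇒ c) → ⊢ ((s & (f ∨ₒ g)) ⇒ c)
∨-elim {s} {f} {g} {c} ss sf sg df dg = mp-under cases (∩-elim-under sh (from f sf df) (from g sg dg))
  where
    h = s & (f ∨ₒ g)
    sh : Stable h
    sh = &-stable ss (⇒-stable ∅ _)
    cases : ⊢ (h ⇒ (‾ f ∩ ‾ g))
    cases = mp-under (A8′ h) (A4r′ s (f ∨ₒ g))
    from : ∀ e → Stable e → ⊢ ((s & e) ⇒ c) → ⊢ (h ⇒ (‾ e ⇒ c))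
    from e se de = trans-under (weaken⇒ sh (‾-elim e)) (⇒-trans (A4l′ s (f ∨ₒ g)) (curry-under ss se de))

class-mono : ∀ {α β} → ⊢ (α ⇒ β) → ⊢ (⟦ vx ∣ β ⟧ ⇒ ⟦ vx ∣ α ⟧)
class-mono d = R1 ⊢∅ (R3 ∅ refl (‾-intro d))

V⇒class : ∀ α → ⊢ (Vₒ ⇒ ⟦ vx ∣ α ⟧)
V⇒class α = class-mono (A8′ α)

-- A13 read at the element x; for concrete α not mentioning a the
-- substitutions in these types compute away to
--   x ∈ {x | α} ⇒ Sing(x) & α   and   Sing(x) & α ⇒ x ∈ {x | α}.
∈-elim : ∀ α → ⊢ (((va ∈ₒ ⟦ vx ∣ α ⟧) ⇒ (Sing va & (α [ vx ≔ va ]))) [ va ≔ vx ])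
∈-elim α = R1 (R2 (∅ ᶜ) vx (A13 α)) (A4l′ _ _)

∈-intro : ∀ α → ⊢ (((Sing va & (α [ vx ≔ va ])) ⇒ (va ∈ₒ ⟦ vx ∣ α ⟧)) [ va ≔ vx ])
∈-intro α = R1 (R2 (∅ ᶜ) vx (A13 α)) (A4r′ _ _)

Sing-stable : Stable (Sing vx)
Sing-stable = &-stable (⇒-stable _ _) (⇒-stable _ _)

∈-antitone : ∀ {c d} e → ⊢ (c ⇒ d) → ⊢ ((e ∈ₒ d) ⇒ (e ∈ₒ c))
∈-antitone {c} {d} e cd = &-under (A4l′ _ _) (⇒-trans (A4r′ (Sing e) (d ⇒ e)) (⇒-antitone e cd))

members-class : ∀ c → Appears vx c ≡ false → ⟦ vx ∣ vx ∈ₒ va ⟧ [ va ≔ c ] ≡ ⟦ vx ∣ vx ∈ₒ c ⟧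
members-class c x∉c = cong (λ z → cls (close 0 vx (Sing vx) & (z ⇒ bnd 0))) (sym (close-fresh 0 vx c x∉c))

-- Extensionality (A14a, R3, A14b): a containment c ⇒ d between x-free
-- objects, d below V, follows from x ∈ d ⇒ x ∈ c.
⇒-by-members : ∀ {c d} → Appears vx c ≡ false → Appears vx d ≡ false →
               ⊢ (Vₒ ⇒ d) → ⊢ ((vx ∈ₒ d) ⇒ (vx ∈ₒ c)) → ⊢ (c ⇒ d)
⇒-by-members {c} {d} x∉c x∉d V⇒d members = ⇒-trans c⇒ (⇒-trans (class-mono members) ⇒d)
  where
    c⇒ : ⊢ (c ⇒ ⟦ vx ∣ vx ∈ₒ c ⟧)
    c⇒ = subst (λ z → ⊢ (c ⇒ z)) (members-class c x∉c) (R2 (∅ ᶜ) c A14a)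
    ⇒d : ⊢ (⟦ vx ∣ vx ∈ₒ d ⟧ ⇒ d)
    ⇒d = R1 V⇒d (subst (λ z → ⊢ ((Vₒ ⇒ d) ⇒ (z ⇒ d))) (members-class d x∉d) (R2 (∅ ᶜ) d A14b))

P Q R S φ ψ Cφ Cψ : Obj
P = std 5
Q = std 6
R = std 7
S = std 8
φ = P ⇒ Q
ψ = R ⇒ S
Cφ = ⟦ vx ∣ φ ⟧
Cψ = ⟦ vx ∣ ψ ⟧

union-equation : ⊢ (⟦ vx ∣ φ ∨ₒ ψ ⟧ ≐ (Cφ & Cψ))
union-equation = &-intro⇒ ⊆ ⊇
  where
    ⊆ : ⊢ (⟦ vx ∣ φ ∨ₒ ψ ⟧ ⇒ (Cφ & Cψ))
    ⊆ = R1 (&-intro⇒ (class-mono (∨-intro-l ψ (⇒-stable P Q))) (class-mono (∨-intro-r φ (⇒-stable R S))))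
           (A3′ _ Cφ Cψ)
    members : ⊢ ((vx ∈ₒ ⟦ vx ∣ φ ∨ₒ ψ ⟧) ⇒ (vx ∈ₒ (Cφ & Cψ)))
    members = ⇒-trans (∈-elim (φ ∨ₒ ψ))
                (∨-elim Sing-stable (⇒-stable P Q) (⇒-stable R S)
                  (⇒-trans (∈-intro φ) (∈-antitone vx (A4l′ Cφ Cψ)))
                  (⇒-trans (∈-intro ψ) (∈-antitone vx (A4r′ Cφ Cψ))))
    ⊇ : ⊢ ((Cφ & Cψ) ⇒ ⟦ vx ∣ φ ∨ₒ ψ ⟧)
    ⊇ = ⇒-by-members refl refl (V⇒class (φ ∨ₒ ψ)) members

meet-equation : ⊢ (⟦ vx ∣ φ & ψ ⟧ ≐ (Cφ ∩ Cψ))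
meet-equation = &-intro⇒ ⊆ ⊇
  where
    holds : ∀ {C} α → ⊢ (C ⇒ (Cφ ∩ Cψ)) → ⊢ ((vx ∈ₒ C) ⇒ (Sing vx & α)) →
            ⊢ ((vx ∈ₒ (Cφ ∩ Cψ)) ⇒ α)
    holds α C⇒ ∈C = ⇒-trans (∈-antitone vx C⇒) (⇒-trans ∈C (A4r′ (Sing vx) α))
    members : ⊢ ((vx ∈ₒ (Cφ ∩ Cψ)) ⇒ (vx ∈ₒ ⟦ vx ∣ φ & ψ ⟧))
    members = ⇒-trans (&-under (A4l′ _ _) (&-under (holds φ (A5l′ Cφ Cψ) (∈-elim φ))
                                                   (holds ψ (A5r′ Cφ Cψ) (∈-elim ψ))))
                      (∈-intro (φ & ψ))
    ⊆ : ⊢ (⟦ vx ∣ φ & ψ ⟧ ⇒ (Cφ ∩ Cψ))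
    ⊆ = ⇒-by-members refl refl (⇒-trans (V⇒class φ) (A5l′ Cφ Cψ)) members
    ⊇ : ⊢ ((Cφ ∩ Cψ) ⇒ ⟦ vx ∣ φ & ψ ⟧)
    ⊇ = R1 (&-intro⇒ (class-mono (A4l′ φ ψ)) (class-mono (A4r′ φ ψ))) (A6′ Cφ Cψ _)

infix 4 _≐ˢ_

_≐ˢ_ : Schema → Schema → Schema
a ≐ˢ b = (a ⇒ˢ b) &ˢ (b ⇒ˢ a)

‾ˢ_ : Schema → Schema
‾ˢ a = ∅ˢ ⇒ˢ a

φˢ ψˢ union-schema meet-schema : Schema
φˢ = # 5 ⇒ˢ # 6
ψˢ = # 7 ⇒ˢ # 8
union-schema = clsˢ (‾ˢ ((‾ˢ φˢ) ∩ˢ (‾ˢ ψˢ))) ≐ˢ (clsˢ φˢ &ˢ clsˢ ψˢ)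
meet-schema = clsˢ (φˢ &ˢ ψˢ) ≐ˢ (clsˢ φˢ ∩ˢ clsˢ ψˢ)

-- Substitute P, Q, R, S by φ₁, φ₂, ψ₁, ψ₂ with x closed to the bound index 0
-- of the surrounding class (x, a, b, c, d are kept).
theorem3p15 : (x φ₁ φ₂ ψ₁ ψ₂ : Obj) → (⊢ (⟦ x ᵛ ∣ (φ₁ ⇒ φ₂) ∨ₒ (ψ₁ ⇒ ψ₂) ⟧ ≐ (⟦ x ᵛ ∣ φ₁ ⇒ φ₂ ⟧ & ⟦ x ᵛ ∣ ψ₁ ⇒ ψ₂ ⟧))) × (⊢ (⟦ x ᵛ ∣ (φ₁ ⇒ φ₂) & (ψ₁ ⇒ ψ₂) ⟧ ≐ (⟦ x ᵛ ∣ φ₁ ⇒ φ₂ ⟧ ∩ ⟦ x ᵛ ∣ ψ₁ ⇒ ψ₂ ⟧)))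
theorem3p15 x φ₁ φ₂ ψ₁ ψ₂ =
  instantiate union-schema env union-equation , instantiate meet-schema env meet-equation
  where
    env : List Obj
    env = vx ∷ va ∷ vb ∷ vc ∷ vd ∷ close 0 (x ᵛ) φ₁ ∷ close 0 (x ᵛ) φ₂ ∷ close 0 (x ᵛ) ψ₁ ∷ close 0 (x ᵛ) ψ₂ ∷ []
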